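{- Let $t$ be a positive integer with $t\equiv 25\pmod{56}$. Then $18107_2^{(t)}=18107\cdot(2^{15t}-1)/(2^{15}-1)$ is a Sierpiński number.
   Context: A Sierpiński number is an odd positive integer $k$ such that $k\cdot 2^n+1$ is composite for all positive integers $n$. For integers $b\ge2$, $k\ge1$, $t\ge1$, the $b$-repinteger is $k_b^{(t)}=k\,(b^{\ell t}-1)/(b^\ell-1)$ with $\ell=\lfloor\log_b k\rfloor+1$; for $k=18107$, $b=2$ one has $\ell=15$. -}

module Defs where

open import Data.Nat using (ℕ; zero; suc; _+_; _*_; _∸_; _^_; _≤_; _<_; NonZero; >-nonZero)
open import Data.Nat.Properties using (m^n>0; ≤-refl; ∸-monoˡ-<)
open import Data.Nat.DivMod using (_/_; _%_)
open import Data.Nat.Logarithm using (⌊log₂_⌋)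
open import Data.Nat.Primality using (Composite)

Sierpinski : ℕ → Set
Sierpinski k = (0 < k) × (k % 2 ≡ 1) × ((n : ℕ) → 1 ≤ n → Composite (k * 2 ^ n + 1))
  where
  open import Data.Product using (_×_)
  open import Relation.Binary.PropositionalEquality using (_≡_)

digits₂ : ℕ → ℕ
digits₂ k = ⌊log₂ k ⌋ + 1

private
  2^suc∸1-nonZero : ∀ m → NonZero (2 ^ suc m ∸ 1)
  2^suc∸1-nonZero m = >-nonZero (∸-monoˡ-< {1} {1} {2 ^ suc m} lem ≤-refl)
    where
    lem : 1 < 2 ^ suc m
    lem = Data.Nat.Properties.*-monoʳ-≤ 2 (m^n>0 2 m)
      where import Data.Nat.Properties

repint₂ : ℕ → ℕ → ℕ
repint₂ k t = _/_ (k * (2 ^ (ℓ * t) ∸ 1)) (2 ^ ℓ ∸ 1) {{nz}}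
  where
  ℓ = digits₂ k
  nz : NonZero (2 ^ ℓ ∸ 1)
  nz rewrite Data.Nat.Properties.+-comm ⌊log₂ k ⌋ 1 = 2^suc∸1-nonZero ⌊log₂ k ⌋
    where import Data.Nat.Properties

module Submission where

-- With ℓ = 15 the repinteger is 18107·R(t), where R(t) = 1 + 2¹⁵ + ⋯ + 2¹⁵⁽ᵗ⁻¹⁾. Writing
-- t = 25 + 56q turns it into k₀ + d₀·x with k₀ = 18107·R(25) and d₀ = 18107·2³⁷⁵·R(56).
-- Every prime of the covering set {3, 5, 7, 13, 17, 241} divides both 2²⁴ − 1 and d₀, and for
-- each r < 24 one of them divides k₀·2ʳ + 1. That prime then divides (k₀ + d₀·x)·2ⁿ + 1 for
-- every n ≡ r (mod 24), and it is smaller than that number.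

open import Data.Fin.Base using (Fin; toℕ; fromℕ<)
open import Data.Fin.Properties using (all?; toℕ-fromℕ<)
open import Data.List.Base using (List; []; _∷_)
open import Data.List.Relation.Unary.Any using (Any; any?; satisfied)
open import Data.Nat.Base
open import Data.Nat.DivMod using (m*n/n≡m; m≡m%n+[m/n]*n; m%n<n; %-remove-+ʳ)
open import Data.Nat.Divisibility using (_∣_; _∣?_; ∣m∣n⇒∣m+n; ∣m⇒∣m*n; m%n≡0⇒n∣m)
open import Data.Nat.Divisibility.Core using (hasNonTrivialDivisor)
open import Data.Nat.Logarithm using (⌊log₂_⌋; ⌊log₂⌋-mono-≤; ⌊log₂[2^n]⌋≡n; ⌊log₂⌊n/2⌋⌋≡⌊log₂n⌋∸1)
open import Data.Nat.Primality using (Composite)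
open import Data.Nat.Properties
open import Data.Nat.Tactic.RingSolver using (solve-∀)
open import Data.Product.Base using (∃-syntax; _×_; _,_)
open import Data.Unit.Base using (tt)
open import Relation.Binary.PropositionalEquality
open import Relation.Nullary.Decidable using (Dec; map′; _×-dec_; toWitness)

open import Defs

repunit : ℕ → ℕ → ℕ
repunit b zero    = 0
repunit b (suc t) = 1 + b * repunit b t

repunit-+ : ∀ b m n → repunit b (m + n) ≡ repunit b m + b ^ m * repunit b n
repunit-+ b zero    n = sym (*-identityˡ (repunit b n))
repunit-+ b (suc m) n = begin
  1 + b * repunit b (m + n)                         ≡⟨ cong (λ x → 1 + b * x) (repunit-+ b m n) ⟩
  1 + b * (repunit b m + b ^ m * repunit b n)       ≡⟨ cong suc (*-distribˡ-+ b _ _) ⟩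
  1 + (b * repunit b m + b * (b ^ m * repunit b n)) ≡⟨ cong (λ x → 1 + (b * repunit b m + x)) (*-assoc b _ _) ⟨
  1 + b * repunit b m + b * b ^ m * repunit b n     ∎
  where open ≡-Reasoning

repunit-* : ∀ b m n → repunit b (m * n) ≡ repunit b m * repunit (b ^ m) n
repunit-* b m zero    = trans (cong (repunit b) (*-zeroʳ m)) (sym (*-zeroʳ (repunit b m)))
repunit-* b m (suc n) = begin
  repunit b (m * suc n)                                   ≡⟨ cong (repunit b) (*-suc m n) ⟩
  repunit b (m + m * n)                                   ≡⟨ repunit-+ b m (m * n) ⟩
  repunit b m + b ^ m * repunit b (m * n)                 ≡⟨ cong (λ x → repunit b m + b ^ m * x) (repunit-* b m n) ⟩
  repunit b m + b ^ m * (repunit b m * repunit (b ^ m) n) ≡⟨ factor (repunit b m) (b ^ m) (repunit (b ^ m) n) ⟩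
  repunit b m * (1 + b ^ m * repunit (b ^ m) n)           ∎
  where
  open ≡-Reasoning
  factor : ∀ x y z → x + y * (x * z) ≡ x * (1 + y * z)
  factor = solve-∀

b^t≡1+[b∸1]*repunit : ∀ b t .{{_ : NonZero b}} → b ^ t ≡ 1 + (b ∸ 1) * repunit b t
b^t≡1+[b∸1]*repunit (suc c) zero    = cong suc (sym (*-zeroʳ c))
b^t≡1+[b∸1]*repunit (suc c) (suc t) =
  trans (cong (suc c *_) (b^t≡1+[b∸1]*repunit (suc c) t)) (expand c (repunit (suc c) t))
  where
  expand : ∀ c r → (1 + c) * (1 + c * r) ≡ 1 + c * (1 + (1 + c) * r)
  expand = solve-∀

*[b^t∸1]/[b∸1]≡*repunit : ∀ k b t .{{_ : NonZero (b ∸ 1)}} → k * (b ^ t ∸ 1) / (b ∸ 1) ≡ k * repunit b t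
*[b^t∸1]/[b∸1]≡*repunit k (suc c) t = begin
  k * (suc c ^ t ∸ 1) / c         ≡⟨ cong (λ x → k * (x ∸ 1) / c) (b^t≡1+[b∸1]*repunit (suc c) t) ⟩
  k * (c * repunit (suc c) t) / c ≡⟨ cong (_/ c) (swap k c (repunit (suc c) t)) ⟩
  k * repunit (suc c) t * c / c   ≡⟨ m*n/n≡m (k * repunit (suc c) t) c ⟩
  k * repunit (suc c) t           ∎
  where
  open ≡-Reasoning
  swap : ∀ k c r → k * (c * r) ≡ k * r * c
  swap = solve-∀

n<2*m⇒⌊n/2⌋<m : ∀ n m → n < 2 * m → ⌊ n /2⌋ < m
n<2*m⇒⌊n/2⌋<m n m n<2m = *-cancelˡ-< 2 ⌊ n /2⌋ m (begin-strict
  2 * ⌊ n /2⌋       ≡⟨ cong (⌊ n /2⌋ +_) (+-identityʳ ⌊ n /2⌋) ⟩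
  ⌊ n /2⌋ + ⌊ n /2⌋ ≤⟨ +-monoʳ-≤ ⌊ n /2⌋ (⌊n/2⌋≤⌈n/2⌉ n) ⟩
  ⌊ n /2⌋ + ⌈ n /2⌉ ≡⟨ ⌊n/2⌋+⌈n/2⌉≡n n ⟩
  n                 <⟨ n<2m ⟩
  2 * m             ∎)
  where open ≤-Reasoning

n<2^[1+k]⇒⌊log₂n⌋≤k : ∀ k n → n < 2 ^ suc k → ⌊log₂ n ⌋ ≤ k
n<2^[1+k]⇒⌊log₂n⌋≤k zero    0             _             = z≤n
n<2^[1+k]⇒⌊log₂n⌋≤k zero    1             _             = z≤n
n<2^[1+k]⇒⌊log₂n⌋≤k zero    (suc (suc n)) (s<s (s<s ()))
n<2^[1+k]⇒⌊log₂n⌋≤k (suc k) n n<2^[2+k] = pred[m]≤k⇒m≤1+k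
  (subst (_≤ k) (⌊log₂⌊n/2⌋⌋≡⌊log₂n⌋∸1 n)
    (n<2^[1+k]⇒⌊log₂n⌋≤k k ⌊ n /2⌋ (n<2*m⇒⌊n/2⌋<m n (2 ^ suc k) n<2^[2+k])))
  where
  pred[m]≤k⇒m≤1+k : ∀ {m} → pred m ≤ k → m ≤ suc k
  pred[m]≤k⇒m≤1+k {zero}  _ = z≤n
  pred[m]≤k⇒m≤1+k {suc m} = s≤s

2^k≤n<2^[1+k]⇒⌊log₂n⌋≡k : ∀ k n → 2 ^ k ≤ n → n < 2 ^ suc k → ⌊log₂ n ⌋ ≡ k
2^k≤n<2^[1+k]⇒⌊log₂n⌋≡k k n 2^k≤n n<2^[1+k] = ≤-antisym
  (n<2^[1+k]⇒⌊log₂n⌋≤k k n n<2^[1+k])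
  (subst (_≤ ⌊log₂ n ⌋) (⌊log₂[2^n]⌋≡n k) (⌊log₂⌋-mono-≤ 2^k≤n))

2^k≤n<2^[1+k]⇒digits₂n≡1+k : ∀ k n → 2 ^ k ≤ n → n < 2 ^ suc k → digits₂ n ≡ suc k
2^k≤n<2^[1+k]⇒digits₂n≡1+k k n 2^k≤n n<2^[1+k] =
  trans (cong (_+ 1) (2^k≤n<2^[1+k]⇒⌊log₂n⌋≡k k n 2^k≤n n<2^[1+k])) (+-comm k 1)

repint₂≡*repunit : ∀ k ℓ t → digits₂ k ≡ ℓ → repint₂ k t ≡ k * repunit (2 ^ ℓ) t
repint₂≡*repunit k .(digits₂ k) t refl = begin
  repint₂ k t                          ≡⟨ cong (λ x → k * (x ∸ 1) / (2 ^ ℓ ∸ 1)) (^-*-assoc 2 ℓ t) ⟨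
  k * ((2 ^ ℓ) ^ t ∸ 1) / (2 ^ ℓ ∸ 1) ≡⟨ *[b^t∸1]/[b∸1]≡*repunit k (2 ^ ℓ) t ⟩
  k * repunit (2 ^ ℓ) t               ∎
  where
  open ≡-Reasoning
  ℓ = digits₂ k
  instance
    2^ℓ∸1-nonZero : NonZero (2 ^ ℓ ∸ 1)
    2^ℓ∸1-nonZero = >-nonZero (m<n⇒0<n∸m (^-monoʳ-≤ 2 (m≤n+m 1 ⌊log₂ k ⌋)))

record Covers (k m r p : ℕ) : Set where
  constructor covers
  field
    isNonTrivial : NonTrivial p
    ∣k*2^r+1     : p ∣ k * 2 ^ r + 1
    ∣2^m∸1       : p ∣ 2 ^ m ∸ 1
    <k*2^r+1     : p < k * 2 ^ r + 1

covers? : ∀ k m r p → Dec (Covers k m r p)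
covers? k m r p = map′ (λ (a , b , c , d) → covers a b c d) (λ (covers a b c d) → a , b , c , d)
  (nonTrivial? p ×-dec p ∣? k * 2 ^ r + 1 ×-dec p ∣? 2 ^ m ∸ 1 ×-dec p <? k * 2 ^ r + 1)

covers⇒composite : ∀ {k m r p} → Covers k m r p → ∀ q → Composite (k * 2 ^ (r + m * q) + 1)
covers⇒composite {k} {m} {r} (covers p-nonTrivial p∣k2ʳ+1 p∣2ᵐ∸1 p<k2ʳ+1) q =
  subst Composite (sym split)
    (hasNonTrivialDivisor {{p-nonTrivial}} (<-≤-trans p<k2ʳ+1 (m≤m+n _ _))
      (∣m∣n⇒∣m+n p∣k2ʳ+1 (∣m⇒∣m*n _ p∣2ᵐ∸1)))
  where
  open ≡-Reasoning
  instance
    2ᵐ-nonZero : NonZero (2 ^ m)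
    2ᵐ-nonZero = m^n≢0 2 m
  R = repunit (2 ^ m) q
  regroup : ∀ k a M R → k * (a * (1 + M * R)) + 1 ≡ (k * a + 1) + M * (k * a * R)
  regroup = solve-∀
  split : k * 2 ^ (r + m * q) + 1 ≡ (k * 2 ^ r + 1) + (2 ^ m ∸ 1) * (k * 2 ^ r * R)
  split = begin
    k * 2 ^ (r + m * q) + 1                         ≡⟨ cong (λ x → k * x + 1) (^-distribˡ-+-* 2 r (m * q)) ⟩
    k * (2 ^ r * 2 ^ (m * q)) + 1                   ≡⟨ cong (λ x → k * (2 ^ r * x) + 1) (^-*-assoc 2 m q) ⟨
    k * (2 ^ r * (2 ^ m) ^ q) + 1                   ≡⟨ cong (λ x → k * (2 ^ r * x) + 1) (b^t≡1+[b∸1]*repunit (2 ^ m) q) ⟩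
    k * (2 ^ r * (1 + (2 ^ m ∸ 1) * R)) + 1         ≡⟨ regroup k (2 ^ r) (2 ^ m ∸ 1) R ⟩
    (k * 2 ^ r + 1) + (2 ^ m ∸ 1) * (k * 2 ^ r * R) ∎

covering⇒composite : ∀ {k} m .{{_ : NonZero m}} → (∀ r → r < m → ∃[ p ] Covers k m r p) →
                     ∀ n → Composite (k * 2 ^ n + 1)
covering⇒composite {k} m covering n with covering (n % m) (m%n<n n m)
... | p , p-covers =
  subst (λ e → Composite (k * 2 ^ e + 1)) (sym n≡r+mq) (covers⇒composite p-covers (n / m))
  where
  n≡r+mq : n ≡ n % m + m * (n / m)
  n≡r+mq = trans (m≡m%n+[m/n]*n n m) (cong (n % m +_) (*-comm (n / m) m))

covers-+-multiple : ∀ {c d m r p} → Covers c m r p → p ∣ d → ∀ x → Covers (c + d * x) m r p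
covers-+-multiple {c} {d} {r = r} {p = p} (covers p-nonTrivial p∣c2ʳ+1 p∣2ᵐ∸1 p<c2ʳ+1) p∣d x = covers
  p-nonTrivial
  (subst (p ∣_) (sym split) (∣m∣n⇒∣m+n p∣c2ʳ+1 (∣m⇒∣m*n _ p∣d)))
  p∣2ᵐ∸1
  (subst (p <_) (sym split) (<-≤-trans p<c2ʳ+1 (m≤m+n _ _)))
  where
  regroup : ∀ c d x a → (c + d * x) * a + 1 ≡ (c * a + 1) + d * (x * a)
  regroup = solve-∀
  split : (c + d * x) * 2 ^ r + 1 ≡ (c * 2 ^ r + 1) + d * (x * 2 ^ r)
  split = regroup c d x (2 ^ r)

covering⇒sierpinski : ∀ {c d} m .{{_ : NonZero m}} → 0 < c → c % 2 ≡ 1 → 2 ∣ d →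
                      (∀ r → r < m → ∃[ p ] Covers c m r p × p ∣ d) → ∀ x → Sierpinski (c + d * x)
covering⇒sierpinski {c} {d} m 0<c c-odd 2∣d covering x =
  <-≤-trans 0<c (m≤m+n c (d * x)) ,
  trans (%-remove-+ʳ c (∣m⇒∣m*n x 2∣d)) c-odd ,
  λ n _ → covering⇒composite m covering′ n
  where
  covering′ : ∀ r → r < m → ∃[ p ] Covers (c + d * x) m r p
  covering′ r r<m with covering r r<m
  ... | p , p-covers , p∣d = p , covers-+-multiple p-covers p∣d x

*repunit-split : ∀ k b a L t c d .{{_ : NonZero L}} → t % L ≡ a →
                 k * repunit b a ≡ c → k * (b ^ a * repunit b L) ≡ d →
                 k * repunit b t ≡ c + d * repunit (b ^ L) (t / L)
*repunit-split k b a L t c d t%L≡a ≡c ≡d = begin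
  k * repunit b t                                                 ≡⟨ cong (λ s → k * repunit b s) t≡a+Lq ⟩
  k * repunit b (a + L * q)                                       ≡⟨ cong (k *_) (repunit-+ b a (L * q)) ⟩
  k * (repunit b a + b ^ a * repunit b (L * q))                   ≡⟨ cong (λ x → k * (repunit b a + b ^ a * x)) (repunit-* b L q) ⟩
  k * (repunit b a + b ^ a * (repunit b L * repunit (b ^ L) q))   ≡⟨ regroup k (repunit b a) (b ^ a) (repunit b L) (repunit (b ^ L) q) ⟩
  k * repunit b a + k * (b ^ a * repunit b L) * repunit (b ^ L) q ≡⟨ cong₂ (λ c d → c + d * repunit (b ^ L) q) ≡c ≡d ⟩
  c + d * repunit (b ^ L) q                                       ∎
  where
  open ≡-Reasoning
  q = t / L
  t≡a+Lq : t ≡ a + L * q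
  t≡a+Lq = trans (m≡m%n+[m/n]*n t L) (cong₂ _+_ t%L≡a (*-comm q L))
  regroup : ∀ k x y z w → k * (x + y * (z * w)) ≡ k * x + k * (y * z) * w
  regroup = solve-∀

-- The type checker cannot afford to normalise ⌊log₂ 18107⌋ (well-founded recursion), nor
-- arithmetic between the huge numerals k₀, d₀ and an open term (unfolded in unary). These terms
-- are therefore only ever matched syntactically: hence the equational arguments ℓ, c and d of
-- repint₂≡*repunit and *repunit-split, and the explicit {k₀} {d₀} below.
digits₂-18107 : digits₂ 18107 ≡ 15
digits₂-18107 =
  2^k≤n<2^[1+k]⇒digits₂n≡1+k 14 18107 (≤ᵇ⇒≤ (2 ^ 14) 18107 tt) (<ᵇ⇒< 18107 (2 ^ 15) tt)

k₀ : ℕ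
k₀ = 18107 * repunit (2 ^ 15) 25

d₀ : ℕ
d₀ = 18107 * ((2 ^ 15) ^ 25 * repunit (2 ^ 15) 56)

k₀-covering : ∀ r → r < 24 → ∃[ p ] Covers k₀ 24 r p × p ∣ d₀
k₀-covering r r<24 =
  subst (λ r → ∃[ p ] Covers k₀ 24 r p × p ∣ d₀) (toℕ-fromℕ< r<24) (satisfied (table (fromℕ< r<24)))
  where
  coveringSet : List ℕ
  coveringSet = 3 ∷ 5 ∷ 7 ∷ 13 ∷ 17 ∷ 241 ∷ []
  table : (i : Fin 24) → Any (λ p → Covers k₀ 24 (toℕ i) p × p ∣ d₀) coveringSet
  table = toWitness {a? = all? λ i → any? (λ p → covers? k₀ 24 (toℕ i) p ×-dec p ∣? d₀) coveringSet} tt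

theorem3p5 : (t : ℕ) → 1 ≤ t → t % 56 ≡ 25 → Sierpinski (repint₂ 18107 t)
theorem3p5 t _ t%56≡25 = subst Sierpinski (sym decomposition)
  (covering⇒sierpinski {k₀} {d₀} 24 z<s refl (m%n≡0⇒n∣m d₀ 2 refl) k₀-covering
    (repunit ((2 ^ 15) ^ 56) (t / 56)))
  where
  decomposition : repint₂ 18107 t ≡ k₀ + d₀ * repunit ((2 ^ 15) ^ 56) (t / 56)
  decomposition = trans (repint₂≡*repunit 18107 15 t digits₂-18107)
    (*repunit-split 18107 (2 ^ 15) 25 56 t k₀ d₀ t%56≡25 refl refl)
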